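{- Let $G$ be an instance of \textsc{Stable Matching} and let $S$ be the set of matchings produced by the Disjoint Stable Matchings algorithm described in the context on input $G$. Then every matching in $S$ is a stable matching of $G$.
   Context: An instance of \textsc{Stable Matching}: a complete bipartite graph $G$ with sides $\mathcal{M}$ (men) and $\mathcal{W}$ (women), $|\mathcal{M}|=|\mathcal{W}|=n$, where each person has a strictly ordered preference list of all persons of the other side (earlier = more preferred). For a perfect matching $M$, $p_M(x)$ is the partner of $x$. A pair $(m,w)$ blocks $M$ if $w$ prefers $m$ to $p_M(w)$ and $m$ prefers $w$ to $p_M(m)$; $M$ is stable if no pair blocks it. "Deleting a pair $(m,w)$" means removing $m$ from $w$'s current list and $w$ from $m$'s current list. Extended Gale-Shapley (GS-Extended), operating on the current (modifiable) lists: all persons start free; while some man $m$ is free: let $w$ be the first woman on $m$'s current list; if some man $p$ is engaged to $w$, make $p$ free; engage $m$ and $w$; for each successor $m'$ of $m$ on $w$'s current list, delete the pair $(m',w)$. Return the set of engaged pairs. Disjoint Stable Matchings algorithm on input $G$: set $S\gets\varnothing$. Compute the woman-optimal stable matching $M_z$ of $G$ (by the woman-proposing Gale-Shapley algorithm on the original lists). Set $X\gets$ GS-Extended$(G)$ (modifying the lists). While $X\cap M_z=\varnothing$: put $S\gets S\cup\{X\}$; for every man $m$, delete the first woman $w$ on $m$'s current list (which is $m$'s partner in $X$) and delete the last man on $w$'s current list (which is $w$'s partner in $X$); then set $X\gets$ GS-Extended on the current lists. After the loop, put $S\gets S\cup\{M_z\}$ and return $S$. -}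

module Defs where

open import Data.Nat using (ℕ)
open import Data.Fin using (Fin; _≟_)
open import Data.List using (List; []; _∷_; _++_; allFin; mapMaybe; foldl; filter)
open import Data.Bool.ListAction using (any)
open import Data.List.Membership.Propositional using (_∈_)
open import Data.List.Relation.Binary.Permutation.Propositional using (_↭_)
open import Data.Maybe using (Maybe; just; nothing)
import Data.Maybe as Maybe
open import Data.Bool using (Bool; true; false; if_then_else_)
open import Data.Product using (Σ; ∃; _×_; _,_; ∃-syntax; proj₁; proj₂)
open import Relation.Nullary using (¬_)
open import Relation.Nullary.Decidable using (⌊_⌋; ¬?)
open import Relation.Binary.PropositionalEquality using (_≡_)
open import Relation.Binary.Construct.Closure.ReflexiveTransitive using (Star)

Lists : ℕ → Set
Lists n = Fin n → List (Fin n)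

record Instance (n : ℕ) : Set where
  field
    mpref : Lists n          -- men's lists of women (earlier = more preferred)
    wpref : Lists n
    mperm : ∀ m → mpref m ↭ allFin n
    wperm : ∀ w → wpref w ↭ allFin n
open Instance public

Prefers : ∀ {n} → List (Fin n) → Fin n → Fin n → Set
Prefers l a b = ∃[ xs ] ∃[ ys ] ∃[ zs ] (l ≡ xs ++ a ∷ ys ++ b ∷ zs)

-- Matchings as sets (lists) of pairs (man , woman).

Matching : ℕ → Set
Matching n = List (Fin n × Fin n)

IsPerfect : ∀ {n} → Matching n → Set
IsPerfect {n} M =
  (∀ (m : Fin n) → ∃[ w ] ((m , w) ∈ M × (∀ w' → (m , w') ∈ M → w' ≡ w)))
  × (∀ (w : Fin n) → ∃[ m ] ((m , w) ∈ M × (∀ m' → (m' , w) ∈ M → m' ≡ m)))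

Blocks : ∀ {n} → Instance n → Matching n → Fin n → Fin n → Set
Blocks G M m w = ∃[ m' ] ∃[ w' ]
  ((m , w') ∈ M × (m' , w) ∈ M × Prefers (wpref G w) m m' × Prefers (mpref G m) w w')

Stable : ∀ {n} → Instance n → Matching n → Set
Stable G M = IsPerfect M × (∀ m w → ¬ Blocks G M m w)

_==_ : ∀ {n} → Fin n → Fin n → Bool
a == b = ⌊ a ≟ b ⌋

upd : ∀ {n} {A : Set} → (Fin n → A) → Fin n → A → Fin n → A
upd f i v j = if j == i then v else f j

upToIncl : ∀ {n} → Fin n → List (Fin n) → List (Fin n)
upToIncl m [] = []
upToIncl m (x ∷ xs) = if x == m then x ∷ [] else x ∷ upToIncl m xs

after : ∀ {n} → Fin n → List (Fin n) → List (Fin n)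
after m [] = []
after m (x ∷ xs) = if x == m then xs else after m xs

elem : ∀ {n} → Fin n → List (Fin n) → Bool
elem j l = any (j ==_) l

removeAll : ∀ {n} → Fin n → List (Fin n) → List (Fin n)
removeAll w l = filter (λ x → ¬? (x ≟ w)) l

dropLast : ∀ {A : Set} → List A → List A
dropLast [] = []
dropLast (x ∷ []) = []
dropLast (x ∷ y ∷ xs) = x ∷ dropLast (y ∷ xs)

-- engagement state: the fiancée (if any) of each man
Eng : ℕ → Set
Eng n = Fin n → Maybe (Fin n)

engagedTo : ∀ {n} → Maybe (Fin n) → Fin n → Bool
engagedTo nothing w = false
engagedTo (just v) w = v == w

engagedPairs : ∀ {n} → Eng n → Matching n
engagedPairs {n} e = mapMaybe (λ m → Maybe.map (m ,_) (e m)) (allFin n)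

-- GS-Extended (man-proposing, modifying current lists), as a
-- small-step relation; any choice of the free man is allowed.

record GSState (n : ℕ) : Set where
  constructor ⟨_,_,_⟩
  field
    mp  : Lists n
    wp  : Lists n
    eng : Eng n

data GSStep {n : ℕ} : GSState n → GSState n → Set where
  propose : ∀ mp wp e m w rest → e m ≡ nothing → mp m ≡ w ∷ rest →
    GSStep ⟨ mp , wp , e ⟩
           ⟨ (λ j → if elem j (after m (wp w)) then removeAll w (mp j) else mp j)
           , upd wp w (upToIncl m (wp w))
           , (λ j → if j == m then just w
                    else (if engagedTo (e j) w then nothing else e j)) ⟩

GSExtended : ∀ {n} → Lists n → Lists n → Lists n → Lists n → Matching n → Set
GSExtended {n} mp wp mp' wp' X = ∃[ e ]
  ( Star GSStep ⟨ mp , wp , (λ _ → nothing) ⟩ ⟨ mp' , wp' , e ⟩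
  × (∀ m → ¬ (e m ≡ nothing))
  × X ≡ engagedPairs e )

WFree : ∀ {n} → Eng n → Fin n → Set
WFree em w = ∀ m → ¬ (em m ≡ just w)

data WGSStep {n : ℕ} (G : Instance n) : Lists n × Eng n → Lists n × Eng n → Set where
  accept-free : ∀ wl em w m rest → WFree em w → wl w ≡ m ∷ rest → em m ≡ nothing →
    WGSStep G (wl , em) (upd wl w rest , upd em m (just w))
  accept-better : ∀ wl em w m rest w₀ → WFree em w → wl w ≡ m ∷ rest →
    em m ≡ just w₀ → Prefers (mpref G m) w w₀ →
    WGSStep G (wl , em) (upd wl w rest , upd em m (just w))
  reject : ∀ wl em w m rest w₀ → WFree em w → wl w ≡ m ∷ rest →
    em m ≡ just w₀ → ¬ Prefers (mpref G m) w w₀ →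
    WGSStep G (wl , em) (upd wl w rest , em)

WomanGS : ∀ {n} → Instance n → Matching n → Set
WomanGS {n} G Mz = ∃[ wl ] ∃[ em ]
  ( Star (WGSStep G) (wpref G , (λ _ → nothing)) (wl , em)
  × (∀ w → WFree em w → wl w ≡ [])
  × Mz ≡ engagedPairs em )

trimMan : ∀ {n} → Lists n × Lists n → Fin n → Lists n × Lists n
trimMan (mp , wp) m with mp m
... | [] = (mp , wp)
... | w ∷ rest = (upd mp m rest , upd wp w (dropLast (wp w)))

trim : ∀ {n} → Lists n → Lists n → Lists n × Lists n
trim {n} mp wp = foldl trimMan (mp , wp) (allFin n)

Disjoint : ∀ {n} → Matching n → Matching n → Set
Disjoint X Y = ∀ p → p ∈ X → ¬ (p ∈ Y)

-- DSMLoop Mz mp wp X S : starting the while loop with current lists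
-- (mp , wp) and current X, the matchings added to S from now on are S.
data DSMLoop {n : ℕ} (Mz : Matching n) : Lists n → Lists n → Matching n → List (Matching n) → Set where
  stop : ∀ mp wp X → (∃[ p ] (p ∈ X × p ∈ Mz)) → DSMLoop Mz mp wp X (Mz ∷ [])
  continue : ∀ mp wp X mp' wp' X' S → Disjoint X Mz →
    GSExtended (proj₁ (trim mp wp)) (proj₂ (trim mp wp)) mp' wp' X' →
    DSMLoop Mz mp' wp' X' S → DSMLoop Mz mp wp X (X ∷ S)

DSM : ∀ {n} → Instance n → List (Matching n) → Set
DSM G S = ∃[ Mz ] ∃[ mp ] ∃[ wp ] ∃[ X ]
  ( WomanGS G Mz
  × GSExtended (mpref G) (wpref G) mp wp X
  × DSMLoop Mz mp wp X S )

-- Mz is stable by the Gale–Shapley argument: every man a woman has proposed to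
-- stays engaged to someone he likes at least as much as her, and her fiancé is
-- among them, so a man she prefers to her fiancé does not prefer her to his fiancée.
--
-- For the other matchings, the current lists stay pruned throughout GS-Extended
-- and the deletions between rounds: they are sublists of the original lists, w is
-- on m's list only if m is on w's, and if w has left m's list then w prefers every
-- man still on her list to m.  A terminated run of GS-Extended engages every man
-- to the head of his list, and that man is the last one on his fiancée's list.  So
-- in a blocking pair (m , w), either w is still on m's list, behind his fiancée,
-- or w prefers her fiancé to m.  Deleting the head of each man's list and the last
-- man of the corresponding woman's list keeps the lists pruned, so the argument
-- applies in every round.

module Submission where

open import Defs
open import Data.Nat using (ℕ; suc)
open import Data.Nat.Properties using (1+n≰n)
open import Data.Fin using (Fin; _≟_; punchOut)
open import Data.Fin.Properties using (any?; all?; ¬∀⟶∃¬; punchOut-injective; injective⇒≤)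
open import Data.Bool using (true; false; if_then_else_)
open import Data.Bool.Properties using (T-≡)
open import Data.Maybe using (just; nothing)
import Data.Maybe as Maybe
open import Data.Maybe.Properties using (just-injective; ≡-dec)
open import Data.Product using (_×_; _,_; ∃-syntax; proj₁; proj₂; uncurry)
open import Data.Sum using (_⊎_; inj₁; inj₂; [_,_]′)
open import Data.Empty using (⊥-elim)
open import Data.List using (List; []; _∷_; [_]; _++_; _∷ʳ_; allFin; mapMaybe; foldl)
open import Data.List.Properties using (filter-accept; ++-assoc; ++-identityʳ; ∷ʳ-injectiveʳ)
open import Data.List.Membership.Propositional using (_∈_; _∉_)
open import Data.List.Membership.Propositional.Properties
  using (∈-++⁺ʳ; ∈-++⁻; ∈-∃++; ∈-filter⁺; ∈-filter⁻; ∈-allFin)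
open import Data.List.Relation.Unary.Any using (here; there)
import Data.List.Relation.Unary.Any as Any
open import Data.List.Relation.Unary.Any.Properties using (any⁺; any⁻)
open import Data.List.Relation.Unary.All.Properties using (All¬⇒¬Any)
open import Data.List.Relation.Unary.AllPairs using () renaming (tail to Unique-tail)
import Data.List.Relation.Unary.Unique.Propositional as UniqueP
open import Data.List.Relation.Unary.Unique.Propositional.Properties using (allFin⁺)
open import Data.List.Relation.Binary.Sublist.Propositional as Sublist
  using (_⊆_; []; _∷_; minimum; ⊆-refl; ⊆-trans)
open import Data.List.Relation.Binary.Sublist.Propositional.Properties
  using (Any-resp-⊆; All-resp-⊆; filter-⊆; ++⁺ʳ)
open import Data.List.Relation.Binary.Permutation.Propositional using (↭-sym; ↭⇒↭ₛ)
open import Data.List.Relation.Binary.Permutation.Propositional.Properties using (∈-resp-↭)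
import Data.List.Relation.Binary.Permutation.Setoid.Properties as PermutationProperties
open import Function using (id; _∘_)
open import Function.Bundles using (Equivalence)
open import Function.Definitions using (Injective)
open import Relation.Binary.Construct.Closure.ReflexiveTransitive using (Star; ε; _◅_)
open import Relation.Binary.PropositionalEquality
  using (_≡_; _≢_; refl; sym; trans; cong; subst; setoid; module ≡-Reasoning)
open import Relation.Nullary using (¬_; Dec; yes; no; ¬?; contradiction)
open import Relation.Nullary.Decidable using (toWitness; fromWitness)

module _ {a} {A : Set a} where

  open UniqueP {A = A} using (Unique; []; _∷_)

  data Before : List A → A → A → Set a where
    here≺  : ∀ {x y xs} → y ∈ xs → Before (x ∷ xs) x y
    there≺ : ∀ {x y z xs} → Before xs x y → Before (z ∷ xs) x y

  Unique⇒∉ : ∀ {x xs} → Unique (x ∷ xs) → x ∉ xs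
  Unique⇒∉ (x≢ ∷ _) = All¬⇒¬Any x≢

  Unique-⊆ : ∀ {xs ys} → xs ⊆ ys → Unique ys → Unique xs
  Unique-⊆ []               []       = []
  Unique-⊆ (_ Sublist.∷ʳ τ) (_ ∷ u)  = Unique-⊆ τ u
  Unique-⊆ (refl ∷ τ)       (x≢ ∷ u) = All-resp-⊆ τ x≢ ∷ Unique-⊆ τ u

  Before⇒∈ʳ : ∀ {l x y} → Before l x y → y ∈ l
  Before⇒∈ʳ (here≺ y∈) = there y∈
  Before⇒∈ʳ (there≺ p) = there (Before⇒∈ʳ p)

  Before-⊆ : ∀ {xs ys x y} → xs ⊆ ys → Before xs x y → Before ys x y
  Before-⊆ (_ Sublist.∷ʳ τ) p          = there≺ (Before-⊆ τ p)
  Before-⊆ (refl ∷ τ)       (here≺ y∈) = here≺ (Any-resp-⊆ τ y∈)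
  Before-⊆ (refl ∷ τ)       (there≺ p) = there≺ (Before-⊆ τ p)

  Before-++ : ∀ xs {ys x y} → x ∈ xs → y ∈ ys → Before (xs ++ ys) x y
  Before-++ (_ ∷ xs) (here refl) y∈ = here≺ (∈-++⁺ʳ xs y∈)
  Before-++ (_ ∷ xs) (there x∈)  y∈ = there≺ (Before-++ xs x∈ y∈)

  Before-asym : ∀ {l x y} → Unique l → Before l x y → ¬ Before l y x
  Before-asym u       (here≺ _)  (here≺ x∈) = Unique⇒∉ u x∈
  Before-asym u       (here≺ _)  (there≺ q) = Unique⇒∉ u (Before⇒∈ʳ q)
  Before-asym u       (there≺ p) (here≺ _)  = Unique⇒∉ u (Before⇒∈ʳ p)
  Before-asym (_ ∷ u) (there≺ p) (there≺ q) = Before-asym u p q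

  Before-irrefl : ∀ {l x} → Unique l → ¬ Before l x x
  Before-irrefl u p = Before-asym u p p

  Before-trans : ∀ {l x y z} → Unique l → Before l x y → Before l y z → Before l x z
  Before-trans u       (here≺ y∈) (here≺ _)  = ⊥-elim (Unique⇒∉ u y∈)
  Before-trans u       (here≺ _)  (there≺ q) = here≺ (Before⇒∈ʳ q)
  Before-trans u       (there≺ p) (here≺ _)  = ⊥-elim (Unique⇒∉ u (Before⇒∈ʳ p))
  Before-trans (_ ∷ u) (there≺ p) (there≺ q) = there≺ (Before-trans u p q)

  Before-total : ∀ {l x y} → x ∈ l → y ∈ l → x ≢ y → Before l x y ⊎ Before l y x
  Before-total (here refl) (here refl) x≢y = ⊥-elim (x≢y refl)
  Before-total (here refl) (there y∈)  _   = inj₁ (here≺ y∈)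
  Before-total (there x∈)  (here refl) _   = inj₂ (here≺ x∈)
  Before-total (there x∈)  (there y∈)  x≢y with Before-total x∈ y∈ x≢y
  ... | inj₁ p = inj₁ (there≺ p)
  ... | inj₂ p = inj₂ (there≺ p)

  Before-prefix : ∀ xs {ys x y} → Unique (xs ++ ys) → Before (xs ++ ys) x y → y ∈ xs → x ∈ xs
  Before-prefix (_ ∷ xs) u       (here≺ _)  _           = here refl
  Before-prefix (_ ∷ xs) u       (there≺ p) (here refl) = ⊥-elim (Unique⇒∉ u (Before⇒∈ʳ p))
  Before-prefix (_ ∷ xs) (_ ∷ u) (there≺ p) (there y∈)  = there (Before-prefix xs u p y∈)

  WeaklyBefore : List A → A → A → Set a
  WeaklyBefore l x y = x ≡ y ⊎ Before l x y

  WeaklyBefore-⊆ : ∀ {xs ys x y} → xs ⊆ ys → WeaklyBefore xs x y → WeaklyBefore ys x y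
  WeaklyBefore-⊆ τ (inj₁ x≡y) = inj₁ x≡y
  WeaklyBefore-⊆ τ (inj₂ p)   = inj₂ (Before-⊆ τ p)

  WeaklyBefore-head : ∀ {x y xs} → y ∈ x ∷ xs → WeaklyBefore (x ∷ xs) x y
  WeaklyBefore-head (here refl) = inj₁ refl
  WeaklyBefore-head (there y∈)  = inj₂ (here≺ y∈)

  Before⇒¬WeaklyBefore : ∀ {l x y} → Unique l → Before l x y → ¬ WeaklyBefore l y x
  Before⇒¬WeaklyBefore u p (inj₁ refl) = Before-irrefl u p
  Before⇒¬WeaklyBefore u p (inj₂ q)    = Before-asym u p q

injective⇒surjective : ∀ {k} (f : Fin k → Fin k) → Injective _≡_ _≡_ f → ∀ y → ∃[ x ] (f x ≡ y)
injective⇒surjective {suc k} f f-inj y with any? (λ x → f x ≟ y)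
... | yes y∈image = y∈image
... | no  y∉image = contradiction (injective⇒≤ f′-injective) (1+n≰n {k})
  where
  y≢f : ∀ x → y ≢ f x
  y≢f x y≡fx = y∉image (x , sym y≡fx)

  f′ : Fin (suc k) → Fin k
  f′ x = punchOut (y≢f x)

  f′-injective : Injective _≡_ _≡_ f′
  f′-injective {a} {b} eq = f-inj (punchOut-injective (y≢f a) (y≢f b) eq)

module _ {n : ℕ} where

  open UniqueP {A = Fin n} using (Unique)

  Prefers⇒Before : ∀ {l : List (Fin n)} {a b} → Prefers l a b → Before l a b
  Prefers⇒Before {a = a} {b} (xs , ys , zs , refl) = go xs
    where
    go : ∀ xs → Before (xs ++ a ∷ ys ++ b ∷ zs) a b
    go []       = here≺ (∈-++⁺ʳ ys (here refl))
    go (_ ∷ xs) = there≺ (go xs)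

  Before⇒Prefers : ∀ {l : List (Fin n)} {a b} → Before l a b → Prefers l a b
  Before⇒Prefers (here≺ b∈) with ys , zs , refl ← ∈-∃++ b∈ = [] , ys , zs , refl
  Before⇒Prefers {x ∷ _} (there≺ p) with xs , ys , zs , refl ← Before⇒Prefers p =
    x ∷ xs , ys , zs , refl

  upd-≡ : ∀ {A : Set} (f : Fin n → A) i v → upd f i v i ≡ v
  upd-≡ f i v with i ≟ i
  ... | yes _  = refl
  ... | no i≢i = ⊥-elim (i≢i refl)

  upd-≢ : ∀ {A : Set} (f : Fin n → A) {i j} v → j ≢ i → upd f i v j ≡ f j
  upd-≢ f {i} {j} v j≢i with j ≟ i
  ... | yes j≡i = ⊥-elim (j≢i j≡i)
  ... | no _    = refl

  upd-⊆ : ∀ {f : Lists n} {i v} → v ⊆ f i → ∀ j → upd f i v j ⊆ f j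
  upd-⊆ {i = i} v⊆ j with j ≟ i
  ... | yes refl = v⊆
  ... | no _     = ⊆-refl

  elem⇒∈ : ∀ {j : Fin n} l → elem j l ≡ true → j ∈ l
  elem⇒∈ l eq = Any.map toWitness (any⁻ _ l (Equivalence.from T-≡ eq))

  elem≡false⇒∉ : ∀ {j : Fin n} {l} → elem j l ≡ false → j ∉ l
  elem≡false⇒∉ eq j∈ with () ← trans (sym (Equivalence.to T-≡ (any⁺ _ (Any.map fromWitness j∈)))) eq

  ∈-removeAll⁻ : ∀ {w x : Fin n} l → x ∈ removeAll w l → x ∈ l × x ≢ w
  ∈-removeAll⁻ {w} l = ∈-filter⁻ (λ x → ¬? (x ≟ w))

  ∈-removeAll⁺ : ∀ {w x : Fin n} {l} → x ∈ l → x ≢ w → x ∈ removeAll w l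
  ∈-removeAll⁺ {w} = ∈-filter⁺ (λ x → ¬? (x ≟ w))

  removeAll-⊆ : ∀ (w : Fin n) l → removeAll w l ⊆ l
  removeAll-⊆ w = filter-⊆ (λ x → ¬? (x ≟ w))

  removeAll-∷ : ∀ {w v : Fin n} r → v ≢ w → removeAll w (v ∷ r) ≡ v ∷ removeAll w r
  removeAll-∷ {w} _ = filter-accept (λ x → ¬? (x ≟ w))

  dropLast-∷ʳ : ∀ (xs : List (Fin n)) x → dropLast (xs ∷ʳ x) ≡ xs
  dropLast-∷ʳ []           x = refl
  dropLast-∷ʳ (_ ∷ [])     x = refl
  dropLast-∷ʳ (y ∷ z ∷ xs) x = cong (y ∷_) (dropLast-∷ʳ (z ∷ xs) x)

  upToIncl-++-after : ∀ (m : Fin n) l → upToIncl m l ++ after m l ≡ l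
  upToIncl-++-after m []      = refl
  upToIncl-++-after m (x ∷ l) with x ≟ m
  ... | yes _ = refl
  ... | no _  = cong (x ∷_) (upToIncl-++-after m l)

  upToIncl-⊆ : ∀ (m : Fin n) l → upToIncl m l ⊆ l
  upToIncl-⊆ m []      = []
  upToIncl-⊆ m (x ∷ l) with x ≟ m
  ... | yes _ = refl ∷ minimum l
  ... | no _  = refl ∷ upToIncl-⊆ m l

  upToIncl-∷ʳ : ∀ {m : Fin n} l → m ∈ l → ∃[ xs ] (upToIncl m l ≡ xs ∷ʳ m)
  upToIncl-∷ʳ {m} (x ∷ l) m∈ with x ≟ m | m∈
  ... | yes refl | _          = [] , refl
  ... | no x≢m   | here refl  = ⊥-elim (x≢m refl)
  ... | no _     | there m∈l  with xs , eq ← upToIncl-∷ʳ l m∈l = x ∷ xs , cong (x ∷_) eq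

  after-∉ : ∀ {m : Fin n} l → Unique l → m ∉ after m l
  after-∉ {m} (x ∷ l) u with x ≟ m
  ... | yes refl = Unique⇒∉ u
  ... | no _     = after-∉ l (Unique-tail u)

  ∈-upToIncl⊎after : ∀ {x : Fin n} m l → x ∈ l → x ∈ upToIncl m l ⊎ x ∈ after m l
  ∈-upToIncl⊎after m l x∈ = ∈-++⁻ (upToIncl m l) (subst (_ ∈_) (sym (upToIncl-++-after m l)) x∈)

  Before-upToIncl-after : ∀ {x y : Fin n} m l → x ∈ upToIncl m l → y ∈ after m l → Before l x y
  Before-upToIncl-after m l x∈ y∈ =
    subst (λ l → Before l _ _) (upToIncl-++-after m l) (Before-++ (upToIncl m l) x∈ y∈)

  module _ (e : Eng n) where

    private
      pairs : List (Fin n) → Matching n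
      pairs = mapMaybe (λ m → Maybe.map (m ,_) (e m))

      ∈-pairs⁻ : ∀ {m w} l → (m , w) ∈ pairs l → e m ≡ just w
      ∈-pairs⁻ (x ∷ l) p∈ with e x in eq
      ... | nothing = ∈-pairs⁻ l p∈
      ... | just _ with p∈
      ...   | here refl = eq
      ...   | there p∈l = ∈-pairs⁻ l p∈l

      ∈-pairs⁺ : ∀ {m w} l → m ∈ l → e m ≡ just w → (m , w) ∈ pairs l
      ∈-pairs⁺ (x ∷ l) (here refl) eq rewrite eq = here refl
      ∈-pairs⁺ (x ∷ l) (there m∈)  eq with e x
      ... | nothing = ∈-pairs⁺ l m∈ eq
      ... | just _  = there (∈-pairs⁺ l m∈ eq)

    ∈-engagedPairs⁻ : ∀ {m w} → (m , w) ∈ engagedPairs e → e m ≡ just w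
    ∈-engagedPairs⁻ = ∈-pairs⁻ (allFin n)

    ∈-engagedPairs⁺ : ∀ {m w} → e m ≡ just w → (m , w) ∈ engagedPairs e
    ∈-engagedPairs⁺ {m} = ∈-pairs⁺ (allFin n) (∈-allFin m)

  Total : Eng n → Set
  Total e = ∀ m → ∃[ w ] (e m ≡ just w)

  Monogamous : Eng n → Set
  Monogamous e = ∀ {m m′ w} → e m ≡ just w → e m′ ≡ just w → m ≡ m′

  ≢nothing⇒Total : ∀ {e : Eng n} → (∀ m → e m ≢ nothing) → Total e
  ≢nothing⇒Total {e} e≢nothing m with e m in eq
  ... | just w  = w , refl
  ... | nothing = ⊥-elim (e≢nothing m eq)

  all-women-engaged⇒Total : ∀ {e : Eng n} → (∀ w → ∃[ m ] (e m ≡ just w)) → Total e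
  all-women-engaged⇒Total {e} engaged m = wife (injective⇒surjective husband husband-injective m)
    where
    husband : Fin n → Fin n
    husband w = proj₁ (engaged w)

    husband-injective : Injective _≡_ _≡_ husband
    husband-injective {a} {b} eq =
      just-injective (trans (sym (proj₂ (engaged a)))
                            (subst (λ m → e m ≡ just b) (sym eq) (proj₂ (engaged b))))

    wife : ∃[ w ] (husband w ≡ m) → ∃[ w ] (e m ≡ just w)
    wife (w , refl) = w , proj₂ (engaged w)

  engagedPairs-perfect : ∀ (e : Eng n) → Total e → Monogamous e → IsPerfect (engagedPairs e)
  engagedPairs-perfect e total mono = partner-of-man , partner-of-woman
    where
    fiancée : Fin n → Fin n
    fiancée m = proj₁ (total m)

    fiancée-injective : Injective _≡_ _≡_ fiancée
    fiancée-injective {a} {b} eq =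
      mono (proj₂ (total a)) (subst (λ w → e b ≡ just w) (sym eq) (proj₂ (total b)))

    partner-of-man : ∀ m → ∃[ w ] ((m , w) ∈ engagedPairs e ×
                                   (∀ w′ → (m , w′) ∈ engagedPairs e → w′ ≡ w))
    partner-of-man m = fiancée m , ∈-engagedPairs⁺ e (proj₂ (total m)) ,
      λ _ p∈ → just-injective (trans (sym (∈-engagedPairs⁻ e p∈)) (proj₂ (total m)))

    partner-of-woman : ∀ w → ∃[ m ] ((m , w) ∈ engagedPairs e ×
                                     (∀ m′ → (m′ , w) ∈ engagedPairs e → m′ ≡ m))
    partner-of-woman w = husband (injective⇒surjective fiancée fiancée-injective w)
      where
      husband : ∃[ m ] (fiancée m ≡ w) →
                ∃[ m ] ((m , w) ∈ engagedPairs e × (∀ m′ → (m′ , w) ∈ engagedPairs e → m′ ≡ m))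
      husband (m , refl) =
        m , ∈-engagedPairs⁺ e (proj₂ (total m)) , λ _ p∈ → mono (∈-engagedPairs⁻ e p∈) (proj₂ (total m))

module _ {n : ℕ} (G : Instance n) where

  open UniqueP {A = Fin n} using (Unique)
  open PermutationProperties (setoid (Fin n)) using (Unique-resp-↭)

  mpref-unique : ∀ m → Unique (mpref G m)
  mpref-unique m = Unique-resp-↭ (↭⇒↭ₛ (↭-sym (mperm G m))) (allFin⁺ n)

  wpref-unique : ∀ w → Unique (wpref G w)
  wpref-unique w = Unique-resp-↭ (↭⇒↭ₛ (↭-sym (wperm G w))) (allFin⁺ n)

  ∈-mpref : ∀ m w → w ∈ mpref G m
  ∈-mpref m w = ∈-resp-↭ (↭-sym (mperm G m)) (∈-allFin w)

  ∈-wpref : ∀ w m → m ∈ wpref G w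
  ∈-wpref w m = ∈-resp-↭ (↭-sym (wperm G w)) (∈-allFin m)

  EngagedNoWorseThan : Eng n → Fin n → Fin n → Set
  EngagedNoWorseThan em m w = ∃[ w′ ] (em m ≡ just w′ × WeaklyBefore (mpref G m) w′ w)

  record Proposed (wl : Lists n) (em : Eng n) (w : Fin n) : Set where
    field
      proposed         : List (Fin n)
      split            : wpref G w ≡ proposed ++ wl w
      proposed-engaged : ∀ {m} → m ∈ proposed → EngagedNoWorseThan em m w
      fiancé-proposed  : ∀ {m} → em m ≡ just w → m ∈ proposed

  WGSInvariant : Lists n × Eng n → Set
  WGSInvariant (wl , em) = (∀ w → Proposed wl em w) × Monogamous em

  Improves : Eng n → Eng n → Set
  Improves em em′ = ∀ {m w} → EngagedNoWorseThan em m w → EngagedNoWorseThan em′ m w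

  ChangesOnly : Eng n → Eng n → Fin n → Fin n → Set
  ChangesOnly em em′ m w = ∀ {x v} → em′ x ≡ just v → (x ≡ m × v ≡ w) ⊎ em x ≡ just v

  module _ {wl : Lists n} {em em′ : Eng n} {w m : Fin n} {rest : List (Fin n)}
           (free : WFree em w) (wl-w : wl w ≡ m ∷ rest)
           (improves : Improves em em′) (changes : ChangesOnly em em′ m w) where

    Proposed-advance : Proposed wl em w → EngagedNoWorseThan em′ m w → Proposed (upd wl w rest) em′ w
    Proposed-advance P m-engaged = record
      { proposed         = proposed ++ [ m ]
      ; split            = split′
      ; proposed-engaged = λ x∈ →
          [ improves ∘ proposed-engaged , (λ { (here refl) → m-engaged }) ]′ (∈-++⁻ proposed x∈)
      ; fiancé-proposed  = fiancé
      }
      where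
      open Proposed P
      open ≡-Reasoning

      split′ : wpref G w ≡ (proposed ++ [ m ]) ++ upd wl w rest w
      split′ = begin
        wpref G w                              ≡⟨ split ⟩
        proposed ++ wl w                       ≡⟨ cong (proposed ++_) wl-w ⟩
        proposed ++ [ m ] ++ rest              ≡⟨ ++-assoc proposed [ m ] rest ⟨
        (proposed ++ [ m ]) ++ rest            ≡⟨ cong ((proposed ++ [ m ]) ++_) (upd-≡ wl w rest) ⟨
        (proposed ++ [ m ]) ++ upd wl w rest w ∎

      fiancé : ∀ {x} → em′ x ≡ just w → x ∈ proposed ++ [ m ]
      fiancé ex with changes ex
      ... | inj₁ (refl , _) = ∈-++⁺ʳ proposed (here refl)
      ... | inj₂ ex′        = ⊥-elim (free _ ex′)

    Proposed-other : ∀ {w″} → w″ ≢ w → Proposed wl em w″ → Proposed (upd wl w rest) em′ w″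
    Proposed-other {w″} w″≢w P = record
      { proposed         = proposed
      ; split            = trans split (cong (proposed ++_) (sym (upd-≢ wl rest w″≢w)))
      ; proposed-engaged = improves ∘ proposed-engaged
      ; fiancé-proposed  = fiancé
      }
      where
      open Proposed P

      fiancé : ∀ {x} → em′ x ≡ just w″ → x ∈ proposed
      fiancé ex with changes ex
      ... | inj₁ (_ , refl) = ⊥-elim (w″≢w refl)
      ... | inj₂ ex′        = fiancé-proposed ex′

    Monogamous-step : Monogamous em → Monogamous em′
    Monogamous-step mono ea eb with changes ea | changes eb
    ... | inj₁ (refl , _) | inj₁ (refl , _) = refl
    ... | inj₁ (_ , refl) | inj₂ eb′        = ⊥-elim (free _ eb′)
    ... | inj₂ ea′        | inj₁ (_ , refl) = ⊥-elim (free _ ea′)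
    ... | inj₂ ea′        | inj₂ eb′        = mono ea′ eb′

    WGSInvariant-step : EngagedNoWorseThan em′ m w →
                        WGSInvariant (wl , em) → WGSInvariant (upd wl w rest , em′)
    WGSInvariant-step m-engaged (history , mono) = history′ , Monogamous-step mono
      where
      history′ : ∀ w″ → Proposed (upd wl w rest) em′ w″
      history′ w″ with w″ ≟ w
      ... | yes refl = Proposed-advance (history w) m-engaged
      ... | no w″≢w  = Proposed-other w″≢w (history w″)

  accept-improves : ∀ {em m w} → (∀ {w′} → em m ≡ just w′ → Before (mpref G m) w w′) →
                    Improves em (upd em m (just w))
  accept-improves {m = m} {w} better {x} (w′ , ex , w′≼w″) with x ≟ m
  ... | no _     = w′ , ex , w′≼w″
  ... | yes refl = w , refl , inj₂ (w≺ w′≼w″)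
    where
    w≺ : ∀ {w″} → WeaklyBefore (mpref G m) w′ w″ → Before (mpref G m) w w″
    w≺ (inj₁ refl)  = better ex
    w≺ (inj₂ w′≺w″) = Before-trans (mpref-unique m) (better ex) w′≺w″

  accept-changes : ∀ {em m w} → ChangesOnly em (upd em m (just w)) m w
  accept-changes {m = m} {x = x} ex with x ≟ m
  ... | yes x≡m = inj₁ (x≡m , sym (just-injective ex))
  ... | no _    = inj₂ ex

  accept-engaged : ∀ {em m w} → EngagedNoWorseThan (upd em m (just w)) m w
  accept-engaged {em} {m} {w} = w , upd-≡ em m (just w) , inj₁ refl

  rejecter-engaged : ∀ {em m w w₀} → em m ≡ just w₀ → ¬ Prefers (mpref G m) w w₀ →
                     EngagedNoWorseThan em m w
  rejecter-engaged {m = m} {w} {w₀} em-m ¬w≺w₀ with w₀ ≟ w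
  ... | yes w₀≡w = w₀ , em-m , inj₁ w₀≡w
  ... | no w₀≢w with Before-total (∈-mpref m w₀) (∈-mpref m w) w₀≢w
  ...   | inj₁ w₀≺w = w₀ , em-m , inj₂ w₀≺w
  ...   | inj₂ w≺w₀ = ⊥-elim (¬w≺w₀ (Before⇒Prefers w≺w₀))

  WGSStep-invariant : ∀ {s t} → WGSStep G s t → WGSInvariant s → WGSInvariant t
  WGSStep-invariant (accept-free wl em w m rest free wl-w em-m) =
    WGSInvariant-step free wl-w (accept-improves unengaged) (accept-changes {em}) (accept-engaged {em})
    where
    unengaged : ∀ {w′} → em m ≡ just w′ → Before (mpref G m) w w′
    unengaged em-m′ with () ← trans (sym em-m) em-m′
  WGSStep-invariant (accept-better wl em w m rest w₀ free wl-w em-m w≺w₀) =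
    WGSInvariant-step free wl-w (accept-improves better) (accept-changes {em}) (accept-engaged {em})
    where
    better : ∀ {w′} → em m ≡ just w′ → Before (mpref G m) w w′
    better em-m′ with refl ← trans (sym em-m) em-m′ = Prefers⇒Before w≺w₀
  WGSStep-invariant (reject wl em w m rest w₀ free wl-w em-m ¬w≺w₀) =
    WGSInvariant-step {em′ = em} free wl-w id inj₂ (rejecter-engaged {em} em-m ¬w≺w₀)

  WGSRun-invariant : ∀ {s t} → Star (WGSStep G) s t → WGSInvariant s → WGSInvariant t
  WGSRun-invariant ε            I = I
  WGSRun-invariant (step ◅ run) I = WGSRun-invariant run (WGSStep-invariant step I)

  WGSInvariant-initial : WGSInvariant (wpref G , λ _ → nothing)
  WGSInvariant-initial = (λ w → record
    { proposed = [] ; split = refl ; proposed-engaged = λ () ; fiancé-proposed = λ () }) , λ ()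

  WomanGS-stable : ∀ {Mz} → WomanGS G Mz → Stable G Mz
  WomanGS-stable (wl , em , run , exhausted , refl) = engagedPairs-perfect em total mono , unblocked
    where
    history : ∀ w → Proposed wl em w
    history = proj₁ (WGSRun-invariant run WGSInvariant-initial)

    mono : Monogamous em
    mono = proj₂ (WGSRun-invariant run WGSInvariant-initial)

    free⇒all-engaged : ∀ {w} → WFree em w → ∀ m → EngagedNoWorseThan em m w
    free⇒all-engaged {w} free m = proposed-engaged (subst (m ∈_) all-proposed (∈-wpref w m))
      where
      open Proposed (history w)
      all-proposed : wpref G w ≡ proposed
      all-proposed = trans split (trans (cong (proposed ++_) (exhausted w free)) (++-identityʳ proposed))

    engaged? : ∀ w → Dec (∃[ m ] (em m ≡ just w))
    engaged? w = any? (λ m → ≡-dec _≟_ (em m) (just w))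

    total : Total em
    total m with all? engaged?
    ... | yes all-engaged = all-women-engaged⇒Total all-engaged m
    ... | no ¬all-engaged with w , ¬engaged ← ¬∀⟶∃¬ n _ engaged? ¬all-engaged
      with w′ , em-m , _ ← free⇒all-engaged (λ m em-m → ¬engaged (m , em-m)) m = w′ , em-m

    unblocked : ∀ m w → ¬ Blocks G (engagedPairs em) m w
    unblocked m w (m′ , w′ , mw′∈ , m′w∈ , w-prefers , m-prefers) =
      m-not-settled (proposed-engaged m-proposed)
      where
      open Proposed (history w)
      m-proposed : m ∈ proposed
      m-proposed = Before-prefix proposed (subst Unique split (wpref-unique w))
        (subst (λ l → Before l m m′) split (Prefers⇒Before w-prefers))
        (fiancé-proposed (∈-engagedPairs⁻ em m′w∈))

      m-not-settled : ¬ EngagedNoWorseThan em m w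
      m-not-settled (w″ , em-m , w″≼w) with refl ← trans (sym em-m) (∈-engagedPairs⁻ em mw′∈) =
        Before⇒¬WeaklyBefore (mpref-unique m) (Prefers⇒Before m-prefers) w″≼w

  record Pruned (mp wp : Lists n) : Set where
    field
      men-⊆     : ∀ m → mp m ⊆ mpref G m
      women-⊆   : ∀ w → wp w ⊆ wpref G w
      symmetric : ∀ {m w} → w ∈ mp m → m ∈ wp w
      deleted   : ∀ m w → w ∈ mp m ⊎ (∀ {x} → x ∈ wp w → Before (wpref G w) x m)

  Pruned-initial : Pruned (mpref G) (wpref G)
  Pruned-initial = record
    { men-⊆     = λ m → ⊆-refl
    ; women-⊆   = λ w → ⊆-refl
    ; symmetric = λ {m} {w} _ → ∈-wpref w m
    ; deleted   = λ m w → inj₁ (∈-mpref m w)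
    }

  AtEnds : Lists n → Lists n → Fin n → Fin n → Set
  AtEnds mp wp m w = (∃[ rest ] (mp m ≡ w ∷ rest)) × (∃[ xs ] (wp w ≡ xs ∷ʳ m))

  EngagedAtEnds : Lists n → Lists n → Eng n → Set
  EngagedAtEnds mp wp e = ∀ {m w} → e m ≡ just w → AtEnds mp wp m w

  EngagedAtEnds⇒Monogamous : ∀ {mp wp e} → EngagedAtEnds mp wp e → Monogamous e
  EngagedAtEnds⇒Monogamous ends ea eb
    with _ , (xs , wp-w) ← ends ea | _ , (ys , wp-w′) ← ends eb =
    ∷ʳ-injectiveʳ xs ys (trans (sym wp-w) wp-w′)

  Pruned-stable : ∀ {mp wp e} → Pruned mp wp → EngagedAtEnds mp wp e → Total e →
                  Stable G (engagedPairs e)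
  Pruned-stable {mp} {wp} {e} P ends total =
    engagedPairs-perfect e total (EngagedAtEnds⇒Monogamous ends) , unblocked
    where
    open Pruned P
    unblocked : ∀ m w → ¬ Blocks G (engagedPairs e) m w
    unblocked m w (m′ , w′ , mw′∈ , m′w∈ , w-prefers , m-prefers)
      with (rest , mp-m) , _ ← ends (∈-engagedPairs⁻ e mw′∈)
         | _ , (xs , wp-w) ← ends (∈-engagedPairs⁻ e m′w∈)
         | deleted m w
    ... | inj₁ w∈ = Before⇒¬WeaklyBefore (mpref-unique m) (Prefers⇒Before m-prefers)
                      (WeaklyBefore-⊆ (men-⊆ m) (subst (λ l → WeaklyBefore l w′ w) (sym mp-m)
                        (WeaklyBefore-head (subst (w ∈_) mp-m w∈))))
    ... | inj₂ better = Before-asym (wpref-unique w) (Prefers⇒Before w-prefers)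
                          (better (subst (m′ ∈_) (sym wp-w) (∈-++⁺ʳ xs (here refl))))

  module Propose {mp wp : Lists n} {e : Eng n} {m w : Fin n} {rest : List (Fin n)}
                 (mp-m : mp m ≡ w ∷ rest) (P : Pruned mp wp) where

    open Pruned P

    rejected : List (Fin n)
    rejected = after m (wp w)

    mp′ : Lists n
    mp′ j = if elem j rejected then removeAll w (mp j) else mp j

    wp′ : Lists n
    wp′ = upd wp w (upToIncl m (wp w))

    e′ : Eng n
    e′ j = if j == m then just w else (if engagedTo (e j) w then nothing else e j)

    mp′-cases : ∀ j → (j ∈ rejected × mp′ j ≡ removeAll w (mp j)) ⊎ (j ∉ rejected × mp′ j ≡ mp j)
    mp′-cases j with elem j rejected in eq
    ... | true  = inj₁ (elem⇒∈ rejected eq , refl)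
    ... | false = inj₂ (elem≡false⇒∉ eq , refl)

    mp′-⊆ : ∀ j → mp′ j ⊆ mp j
    mp′-⊆ j with mp′-cases j
    ... | inj₁ (_ , eq) = subst (_⊆ mp j) (sym eq) (removeAll-⊆ w (mp j))
    ... | inj₂ (_ , eq) = subst (_⊆ mp j) (sym eq) ⊆-refl

    wp′-⊆ : ∀ w″ → wp′ w″ ⊆ wp w″
    wp′-⊆ w″ with w″ ≟ w
    ... | yes refl = upToIncl-⊆ m (wp w)
    ... | no _     = ⊆-refl

    ∈-mp′ : ∀ {j x} → x ∈ mp′ j → x ≡ w → j ∉ rejected
    ∈-mp′ {j} x∈ refl with mp′-cases j
    ... | inj₁ (_ , eq)  = ⊥-elim (proj₂ (∈-removeAll⁻ (mp j) (subst (_ ∈_) eq x∈)) refl)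
    ... | inj₂ (j∉ , _) = j∉

    mp′-keeps : ∀ {j x} → x ∈ mp j → x ≢ w → x ∈ mp′ j
    mp′-keeps {j} x∈ x≢w with mp′-cases j
    ... | inj₁ (_ , eq) = subst (_ ∈_) (sym eq) (∈-removeAll⁺ x∈ x≢w)
    ... | inj₂ (_ , eq) = subst (_ ∈_) (sym eq) x∈

    symmetric′ : ∀ {j w″} → w″ ∈ mp′ j → j ∈ wp′ w″
    symmetric′ {j} {w″} w″∈ with w″ ≟ w
    ... | no _     = symmetric (Any-resp-⊆ (mp′-⊆ j) w″∈)
    ... | yes refl with ∈-upToIncl⊎after m (wp w) (symmetric (Any-resp-⊆ (mp′-⊆ j) w″∈))
    ...   | inj₁ j∈kept     = j∈kept
    ...   | inj₂ j∈rejected = ⊥-elim (∈-mp′ w″∈ refl j∈rejected)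

    deleted′ : ∀ j w″ → w″ ∈ mp′ j ⊎ (∀ {x} → x ∈ wp′ w″ → Before (wpref G w″) x j)
    deleted′ j w″ with deleted j w″
    ... | inj₂ better = inj₂ (better ∘ Any-resp-⊆ (wp′-⊆ w″))
    ... | inj₁ w″∈ with w″ ≟ w
    ...   | no w″≢w  = inj₁ (mp′-keeps w″∈ w″≢w)
    ...   | yes refl with mp′-cases j
    ...     | inj₂ (_ , eq)          = inj₁ (subst (w ∈_) (sym eq) w″∈)
    ...     | inj₁ (j∈rejected , _) =
      inj₂ λ x∈ → Before-⊆ (women-⊆ w) (Before-upToIncl-after m (wp w) x∈ j∈rejected)

    Pruned′ : Pruned mp′ wp′
    Pruned′ = record
      { men-⊆     = λ j → ⊆-trans (mp′-⊆ j) (men-⊆ j)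
      ; women-⊆   = λ w″ → ⊆-trans (wp′-⊆ w″) (women-⊆ w″)
      ; symmetric = symmetric′
      ; deleted   = deleted′
      }

    e′-just : ∀ {j v} → e′ j ≡ just v → (j ≡ m × v ≡ w) ⊎ (e j ≡ just v × v ≢ w)
    e′-just {j} ej with j ≟ m
    ... | yes j≡m = inj₁ (j≡m , sym (just-injective ej))
    ... | no _ with e j
    ...   | just u with u ≟ w
    ...     | no u≢w = inj₂ (ej , λ v≡w → u≢w (trans (just-injective ej) v≡w))

    wp-unique : ∀ w″ → Unique (wp w″)
    wp-unique w″ = Unique-⊆ (women-⊆ w″) (wpref-unique w″)

    proposer-at-ends : AtEnds mp′ wp′ m w
    proposer-at-ends = (rest , proposer-head) , proposer-last
      where
      proposer-head : mp′ m ≡ w ∷ rest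
      proposer-head with mp′-cases m
      ... | inj₁ (m∈rejected , _) = ⊥-elim (after-∉ (wp w) (wp-unique w) m∈rejected)
      ... | inj₂ (_ , eq)         = trans eq mp-m

      proposer-last : ∃[ xs ] (wp′ w ≡ xs ∷ʳ m)
      proposer-last with xs , eq ← upToIncl-∷ʳ (wp w) (symmetric (subst (w ∈_) (sym mp-m) (here refl))) =
        xs , trans (upd-≡ wp w _) eq

    EngagedAtEnds′ : EngagedAtEnds mp wp e → EngagedAtEnds mp′ wp′ e′
    EngagedAtEnds′ ends {j} ej with e′-just {j} ej
    ... | inj₁ (refl , refl) = proposer-at-ends
    ... | inj₂ (ej′ , v≢w) with (r , mp-j) , (xs , wp-v) ← ends ej′ =
      head-kept , xs , trans (upd-≢ wp _ v≢w) wp-v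
      where
      head-kept : ∃[ r′ ] (mp′ j ≡ _ ∷ r′)
      head-kept with mp′-cases j
      ... | inj₁ (_ , eq) = removeAll w r , trans eq (trans (cong (removeAll w) mp-j) (removeAll-∷ r v≢w))
      ... | inj₂ (_ , eq) = r , trans eq mp-j

  GSInvariant : GSState n → Set
  GSInvariant ⟨ mp , wp , e ⟩ = Pruned mp wp × EngagedAtEnds mp wp e

  GSStep-invariant : ∀ {s t} → GSStep s t → GSInvariant s → GSInvariant t
  GSStep-invariant (propose mp wp e m w rest _ mp-m) (P , ends) = Pruned′ , EngagedAtEnds′ ends
    where open Propose {e = e} mp-m P

  GSRun-invariant : ∀ {s t} → Star GSStep s t → GSInvariant s → GSInvariant t
  GSRun-invariant ε            I = I
  GSRun-invariant (step ◅ run) I = GSRun-invariant run (GSStep-invariant step I)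

  module TrimMan {mp wp : Lists n} {m w : Fin n} {rest xs : List (Fin n)}
                 (P : Pruned mp wp) (mp-m : mp m ≡ w ∷ rest) (wp-w : wp w ≡ xs ∷ʳ m) where

    open Pruned P

    mp′ : Lists n
    mp′ = upd mp m rest

    wp′ : Lists n
    wp′ = upd wp w xs

    mp′-⊆ : ∀ j → mp′ j ⊆ mp j
    mp′-⊆ = upd-⊆ (subst (rest ⊆_) (sym mp-m) (w Sublist.∷ʳ ⊆-refl))

    wp′-⊆ : ∀ w″ → wp′ w″ ⊆ wp w″
    wp′-⊆ = upd-⊆ (subst (xs ⊆_) (sym wp-w) (++⁺ʳ [ m ] ⊆-refl))

    symmetric′ : ∀ {j w″} → w″ ∈ mp′ j → j ∈ wp′ w″
    symmetric′ {j} {w″} w″∈ with j ≟ m | w″ ≟ w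
    ... | yes refl | yes refl =
      ⊥-elim (Unique⇒∉ (subst Unique mp-m (Unique-⊆ (men-⊆ m) (mpref-unique m))) w″∈)
    ... | yes refl | no _     = symmetric (subst (w″ ∈_) (sym mp-m) (there w″∈))
    ... | no j≢m   | yes refl with ∈-++⁻ xs (subst (j ∈_) wp-w (symmetric w″∈))
    ...   | inj₁ j∈xs       = j∈xs
    ...   | inj₂ (here j≡m) = ⊥-elim (j≢m j≡m)
    symmetric′ w″∈ | no _ | no _ = symmetric w″∈

    deleted′ : ∀ j w″ → w″ ∈ mp′ j ⊎ (∀ {x} → x ∈ wp′ w″ → Before (wpref G w″) x j)
    deleted′ j w″ with deleted j w″
    ... | inj₂ better = inj₂ (better ∘ Any-resp-⊆ (wp′-⊆ w″))
    ... | inj₁ w″∈ with j ≟ m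
    ...   | no _ = inj₁ w″∈
    ...   | yes refl with w″ ≟ w | subst (w″ ∈_) mp-m w″∈
    ...     | yes refl | _             = inj₂ λ x∈ → Before-⊆ (women-⊆ w)
      (subst (λ l → Before l _ m) (sym wp-w) (Before-++ xs x∈ (here refl)))
    ...     | no w″≢w  | here w″≡w     = ⊥-elim (w″≢w w″≡w)
    ...     | no _     | there w″∈rest = inj₁ w″∈rest

    Pruned′ : Pruned mp′ wp′
    Pruned′ = record
      { men-⊆     = λ j → ⊆-trans (mp′-⊆ j) (men-⊆ j)
      ; women-⊆   = λ w″ → ⊆-trans (wp′-⊆ w″) (women-⊆ w″)
      ; symmetric = symmetric′
      ; deleted   = deleted′
      }

  trimMan-≡ : ∀ {mp wp : Lists n} {m w rest xs} → mp m ≡ w ∷ rest → wp w ≡ xs ∷ʳ m →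
              trimMan (mp , wp) m ≡ (upd mp m rest , upd wp w xs)
  trimMan-≡ {m = m} {xs = xs} mp-m wp-w rewrite mp-m | wp-w | dropLast-∷ʳ xs m = refl

  Pruned-trimMen : ∀ {e} → Total e → ∀ ms → Unique ms → ∀ {mp wp} → Pruned mp wp →
                   (∀ {m w} → m ∈ ms → e m ≡ just w → AtEnds mp wp m w) →
                   uncurry Pruned (foldl trimMan (mp , wp) ms)
  Pruned-trimMen total []       _ P _ = P
  Pruned-trimMen {e} total (m ∷ ms) u {mp} {wp} P ends
    with w , em ← total m
    with (rest , mp-m) , (xs , wp-w) ← ends (here refl) em =
    subst (λ s → uncurry Pruned (foldl trimMan s ms)) (sym (trimMan-≡ mp-m wp-w))
      (Pruned-trimMen total ms (Unique-tail u) (TrimMan.Pruned′ P mp-m wp-w) ends′)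
    where
    ends′ : ∀ {m″ w″} → m″ ∈ ms → e m″ ≡ just w″ → AtEnds (upd mp m rest) (upd wp w xs) m″ w″
    ends′ {m″} {w″} m″∈ em″ with (r″ , mp-m″) , (ys , wp-w″) ← ends (there m″∈) em″ =
      (r″ , trans (upd-≢ mp rest m″≢m) mp-m″) , (ys , trans (upd-≢ wp xs w″≢w) wp-w″)
      where
      m″≢m : m″ ≢ m
      m″≢m refl = Unique⇒∉ u m″∈
      w″≢w : w″ ≢ w
      w″≢w refl = m″≢m (∷ʳ-injectiveʳ ys xs (trans (sym wp-w″) wp-w))

  Pruned-trim : ∀ {mp wp e} → Pruned mp wp → EngagedAtEnds mp wp e → Total e →
                uncurry Pruned (trim mp wp)
  Pruned-trim P ends total = Pruned-trimMen total (allFin n) (allFin⁺ n) P (λ _ → ends)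

  GSOutcome : Lists n → Lists n → Matching n → Set
  GSOutcome mp wp X = ∃[ e ] (GSInvariant ⟨ mp , wp , e ⟩ × Total e × X ≡ engagedPairs e)

  GSExtended-outcome : ∀ {mp wp mp′ wp′ X} → Pruned mp wp →
                       GSExtended mp wp mp′ wp′ X → GSOutcome mp′ wp′ X
  GSExtended-outcome P (e , run , engaged , X≡) =
    e , GSRun-invariant run (P , λ ()) , ≢nothing⇒Total engaged , X≡

  GSOutcome-stable : ∀ {mp wp X} → GSOutcome mp wp X → Stable G X
  GSOutcome-stable (e , (P , ends) , total , refl) = Pruned-stable P ends total

  DSMLoop-stable : ∀ {Mz mp wp X S} → Stable G Mz → DSMLoop Mz mp wp X S → GSOutcome mp wp X →
                   ∀ {M} → M ∈ S → Stable G M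
  DSMLoop-stable Mz-stable (stop _ _ _ _)                 _       (here refl) = Mz-stable
  DSMLoop-stable Mz-stable (continue _ _ _ _ _ _ _ _ _ _) outcome (here refl) = GSOutcome-stable outcome
  DSMLoop-stable Mz-stable (continue _ _ _ _ _ _ _ _ gs loop) (_ , (P , ends) , total , _) (there M∈S) =
    DSMLoop-stable Mz-stable loop (GSExtended-outcome (Pruned-trim P ends total) gs) M∈S

lemma5 : (n : ℕ) (G : Instance n) (S : List (Matching n)) →
    DSM G S → (M : Matching n) → M ∈ S → Stable G M
lemma5 n G S (Mz , mp , wp , X , womanGS , gs , loop) M M∈S =
  DSMLoop-stable G (WomanGS-stable G womanGS) loop (GSExtended-outcome G (Pruned-initial G) gs) M∈S
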